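{- Let $G=(V,E)$ be a loop-free multigraph and, for each $v\in V$, let $\varphi_v:\mathbb{Z}_+\to\mathbb{R}$ be an arbitrary function. Define $f(\emptyset)=0$ and, for each non-empty $V'\subseteq V$ (in order of increasing $|V'|$), $f(V')=\min_{v\in V'}\{f(V'\setminus\{v\})+\varphi_v(d(v,V'))\}$, and let $g(V')$ be any element of $\arg\min_{v\in V'}\{f(V'\setminus\{v\})+\varphi_v(d(v,V'))\}$. Then for every non-empty $V'\subseteq V$, the minimum of $\sum_{v\in V'}\varphi_v(\overleftarrow{d}(v))$ over all vertex orders of the induced subgraph $G[V']$ equals $f(V')$, and there exists an order attaining this minimum whose last vertex is $g(V')$.
   Context: $d(v,V')$ denotes the number of edges (with multiplicity) joining $v$ to vertices of $V'$. A vertex order of a graph $H$ is a linear ordering $(\sigma_1,\dots,\sigma_m)$ of its vertices; the left-degree $\overleftarrow{d}(v)$ of $v=\sigma_i$ (in $H$) is the number of edges of $H$ joining $v$ to $\{\sigma_1,\dots,\sigma_{i-1}\}$. -}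

module Defs where

open import Level using (Level; suc; _⊔_)
open import Data.Nat as ℕ using (ℕ)
open import Data.Bool using (Bool; true; false; if_then_else_)
open import Data.Fin using (Fin)
open import Data.Fin.Subset using (Subset; _∈_; _-_; ⊥; Nonempty)
open import Data.List using (List; []; _∷_; _++_; [_]; map; allFin)
open import Data.Nat.ListAction using (sum)
open import Data.List.Membership.Propositional renaming (_∈_ to _∈ₗ_)
open import Data.List.Relation.Unary.Unique.Propositional using (Unique)
open import Data.Vec using (lookup)
open import Data.Product using (Σ; _×_; _,_; ∃)
open import Data.Sum using (_⊎_)
open import Relation.Binary.PropositionalEquality using (_≡_)
open import Function.Bundles using (_⇔_)

-- A totally ordered commutative monoid (with propositional equality).
-- The reals (ℝ, +, 0, ≤) are an instance.
record TotalOrderedCommMonoid (c ℓ : Level) : Set (Level.suc (c ⊔ ℓ)) where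
  infixl 6 _+_
  infix 4 _≤_
  field
    Carrier  : Set c
    _+_      : Carrier → Carrier → Carrier
    0#       : Carrier
    _≤_      : Carrier → Carrier → Set ℓ
    +-assoc  : ∀ x y z → (x + y) + z ≡ x + (y + z)
    +-comm   : ∀ x y → x + y ≡ y + x
    +-identityˡ : ∀ x → 0# + x ≡ x
    ≤-refl   : ∀ {x} → x ≤ x
    ≤-trans  : ∀ {x y z} → x ≤ y → y ≤ z → x ≤ z
    ≤-antisym : ∀ {x y} → x ≤ y → y ≤ x → x ≡ y
    ≤-total  : ∀ x y → x ≤ y ⊎ y ≤ x
    +-mono-≤ : ∀ {x x′ y y′} → x ≤ x′ → y ≤ y′ → x + y ≤ x′ + y′

record Multigraph (n : ℕ) : Set where
  field
    mult     : Fin n → Fin n → ℕ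
    symmetric : ∀ u v → mult u v ≡ mult v u
    loopFree : ∀ v → mult v v ≡ 0

module _ {n : ℕ} (G : Multigraph n) where
  open Multigraph G

  deg : Fin n → Subset n → ℕ
  deg v V′ = sum (map (λ u → if lookup V′ u then mult v u else 0) (allFin n))

  degList : Fin n → List (Fin n) → ℕ
  degList v us = sum (map (mult v) us)

  IsVertexOrder : Subset n → List (Fin n) → Set
  IsVertexOrder V′ σ = Unique σ × (∀ v → (v ∈ₗ σ) ⇔ (v ∈ V′))

  module _ {c ℓ} (M : TotalOrderedCommMonoid c ℓ) where
    open TotalOrderedCommMonoid M

    -- Σ_i φ_{σ_i}(left-degree of σ_i), where `pre` holds the earlier vertices
    costFrom : (Fin n → ℕ → Carrier) → List (Fin n) → List (Fin n) → Carrier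
    costFrom φ pre []      = 0#
    costFrom φ pre (v ∷ σ) = φ v (degList v pre) + costFrom φ (v ∷ pre) σ

    orderCost : (Fin n → ℕ → Carrier) → List (Fin n) → Carrier
    orderCost φ σ = costFrom φ [] σ

    IsF : (Fin n → ℕ → Carrier) → (Subset n → Carrier) → Set (c ⊔ ℓ)
    IsF φ f =
      (f ⊥ ≡ 0#) ×
      (∀ V′ → Nonempty V′ →
         (∀ v → v ∈ V′ → f V′ ≤ f (V′ - v) + φ v (deg v V′)) ×
         (∃ λ v → v ∈ V′ × f V′ ≡ f (V′ - v) + φ v (deg v V′)))

    IsG : (Fin n → ℕ → Carrier) → (Subset n → Carrier) → (Subset n → Fin n) → Set c
    IsG φ f g = ∀ V′ → Nonempty V′ →
      (g V′ ∈ V′) × (f V′ ≡ f (V′ - g V′) + φ (g V′) (deg (g V′) V′))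

{-# OPTIONS --safe #-}
-- Deleting the last vertex v of an order of V′ leaves an order of V′ - v, and the left-degree
-- of v is then d(v, V′) (there are no loops).  So the cost of an order ending in v is the cost
-- of an order of V′ - v plus φ_v(d(v, V′)): induction on the order from its end gives f ≤ cost,
-- and appending an argmin vertex to an optimal order of V′ - v attains f(V′).
module Submission where

open import Defs
open import Level using (Level)
open import Data.Nat using (ℕ)
open import Data.Fin using (Fin)
open import Data.Fin.Subset using (Subset; Nonempty)
open import Data.List using (List; _++_; [_])
open import Data.Product using (Σ; _×_; ∃)
open import Relation.Binary.PropositionalEquality using (_≡_)

open import Data.Nat using (zero; suc; _+_)
import Data.Nat.Properties as ℕ
open import Algebra.Properties.CommutativeSemigroup ℕ.+-commutativeSemigroup
  using (x∙yz≈y∙xz; x∙yz≈yx∙z)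
open import Data.Fin using (zero; suc; _≟_)
open import Data.Fin.Subset using (_∈_; _∉_; _-_; _⊂_; ⁅_⁆; ⊥; Empty)
open import Data.Fin.Subset.Properties
  using (p─q⊆p; p─⊥≡p; x∈p∧x≢y⇒x∈p-y; x∈p⇒p-x⊂p; Empty-unique; nonempty?)
open import Data.Fin.Subset.Induction using (Acc; acc; ⊂-wellFounded)
open import Data.Vec.Base using ([]; _∷_; here; there; lookup)
open import Data.Bool using (if_then_else_)
open import Data.List using ([]; _∷_; _∷ʳ_; map; tabulate)
open import Data.List.Properties using (map-tabulate)
open import Data.List.Reverse using (Reverse; []; _∶_∶ʳ_; reverseView)
open import Data.Nat.ListAction using (sum)
open import Data.List.Membership.Propositional using () renaming (_∈_ to _∈ₗ_)
open import Data.List.Relation.Unary.Any using (here; there)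
import Data.List.Relation.Unary.All as All
open import Data.List.Relation.Unary.AllPairs using ([]; _∷_)
open import Data.List.Relation.Unary.Unique.Propositional.Properties using (Unique[x∷xs]⇒x∉xs)
open import Data.List.Relation.Binary.Permutation.Propositional using (_↭_; ↭-sym; ↭⇒↭ₛ)
open import Data.List.Relation.Binary.Permutation.Propositional.Properties using (∈-resp-↭; ∷↭∷ʳ)
import Data.List.Relation.Binary.Permutation.Setoid.Properties as Permutationₛ
open import Data.Product using (_,_; proj₁; proj₂)
open import Relation.Binary.Bundles using (Preorder)
import Relation.Binary.Reasoning.Preorder as PreorderReasoning
open import Relation.Binary.PropositionalEquality
  using (_≢_; refl; sym; trans; cong; cong₂; setoid; isEquivalence; module ≡-Reasoning)
open import Relation.Nullary using (yes; no; contradiction)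
open import Function using (_∘_; case_of_)
open import Function.Bundles using (mk⇔; Equivalence)

open Equivalence using (to; from)

private variable n : ℕ

x∉p-x : ∀ (p : Subset n) x → x ∉ p - x
x∉p-x (_ ∷ p) zero    ()
x∉p-x (_ ∷ p) (suc x) (there x∈p-x) = x∉p-x p x x∈p-x

x∈p-y⇒x∈p : ∀ {p : Subset n} {x y} → x ∈ p - y → x ∈ p
x∈p-y⇒x∈p {p = p} {y = y} = p─q⊆p p ⁅ y ⁆

x∈p-y⇒x≢y : ∀ {p : Subset n} {x y} → x ∈ p - y → x ≢ y
x∈p-y⇒x≢y {p = p} x∈p-x refl = x∉p-x p _ x∈p-x

subsetSum : (Fin n → ℕ) → Subset n → ℕ
subsetSum h []      = 0
subsetSum h (b ∷ p) = (if b then h zero else 0) + subsetSum (h ∘ suc) p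

subsetSum-⊥ : ∀ (h : Fin n → ℕ) → subsetSum h ⊥ ≡ 0
subsetSum-⊥ {zero}  h = refl
subsetSum-⊥ {suc n} h = subsetSum-⊥ (h ∘ suc)

subsetSum-remove : ∀ (h : Fin n → ℕ) {p x} → x ∈ p → subsetSum h p ≡ h x + subsetSum h (p - x)
subsetSum-remove h {_ ∷ p} here = cong (λ q → h zero + subsetSum (h ∘ suc) q) (sym (p─⊥≡p p))
subsetSum-remove h {b ∷ p} {suc x} (there x∈p) = begin
  c + subsetSum (h ∘ suc) p                      ≡⟨ cong (c +_) (subsetSum-remove (h ∘ suc) x∈p) ⟩
  c + (h (suc x) + subsetSum (h ∘ suc) (p - x))  ≡⟨ x∙yz≈y∙xz c (h (suc x)) _ ⟩
  h (suc x) + (c + subsetSum (h ∘ suc) (p - x))  ∎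
  where
  open ≡-Reasoning
  c = if b then h zero else 0

sum-tabulate≡subsetSum : ∀ (h : Fin n → ℕ) p →
  sum (tabulate (λ u → if lookup p u then h u else 0)) ≡ subsetSum h p
sum-tabulate≡subsetSum h []      = refl
sum-tabulate≡subsetSum h (b ∷ p) =
  cong ((if b then h zero else 0) +_) (sum-tabulate≡subsetSum (h ∘ suc) p)

module _ (G : Multigraph n) where
  open Multigraph G

  vertexOrder-[]⁻ : ∀ {V′} → IsVertexOrder G V′ [] → Empty V′
  vertexOrder-[]⁻ (_ , mem) (v , v∈V′) = case from (mem v) v∈V′ of λ ()

  vertexOrder-[]⁺ : ∀ {V′} → Empty V′ → IsVertexOrder G V′ []
  vertexOrder-[]⁺ V′-empty = [] , λ v → mk⇔ (λ ()) (λ v∈V′ → contradiction (v , v∈V′) V′-empty)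

  vertexOrder-∷⁻ : ∀ {V′ v σ} → IsVertexOrder G V′ (v ∷ σ) → v ∈ V′ × IsVertexOrder G (V′ - v) σ
  vertexOrder-∷⁻ {V′} {v} {σ} (unique@(_ ∷ uσ) , mem) =
    to (mem v) (here refl) , uσ , λ w → mk⇔ (into w) (back w)
    where
    into : ∀ w → w ∈ₗ σ → w ∈ V′ - v
    into w w∈σ = x∈p∧x≢y⇒x∈p-y (to (mem w) (there w∈σ))
                               (λ { refl → Unique[x∷xs]⇒x∉xs unique w∈σ })
    back : ∀ w → w ∈ V′ - v → w ∈ₗ σ
    back w w∈V′-v with from (mem w) (x∈p-y⇒x∈p w∈V′-v)
    ... | here w≡v  = contradiction w≡v (x∈p-y⇒x≢y w∈V′-v)
    ... | there w∈σ = w∈σ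

  vertexOrder-∷⁺ : ∀ {V′ v σ} → v ∈ V′ → IsVertexOrder G (V′ - v) σ → IsVertexOrder G V′ (v ∷ σ)
  vertexOrder-∷⁺ {V′} {v} {σ} v∈V′ (uσ , mem) =
    All.tabulate (λ w∈σ v≡w → x∈p-y⇒x≢y (to (mem _) w∈σ) (sym v≡w)) ∷ uσ ,
    λ w → mk⇔ (into w) (back w)
    where
    into : ∀ w → w ∈ₗ v ∷ σ → w ∈ V′
    into w (here refl)  = v∈V′
    into w (there w∈σ) = x∈p-y⇒x∈p (to (mem w) w∈σ)
    back : ∀ w → w ∈ V′ → w ∈ₗ v ∷ σ
    back w w∈V′ with w ≟ v
    ... | yes w≡v = here w≡v
    ... | no  w≢v = there (from (mem w) (x∈p∧x≢y⇒x∈p-y w∈V′ w≢v))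

  vertexOrder-resp-↭ : ∀ {V′ σ σ′} → σ ↭ σ′ → IsVertexOrder G V′ σ → IsVertexOrder G V′ σ′
  vertexOrder-resp-↭ σ↭σ′ (uσ , mem) =
    Permutationₛ.Unique-resp-↭ (setoid _) (↭⇒↭ₛ σ↭σ′) uσ ,
    λ w → mk⇔ (to (mem w) ∘ ∈-resp-↭ (↭-sym σ↭σ′)) (∈-resp-↭ σ↭σ′ ∘ from (mem w))

  vertexOrder-∷ʳ⁻ : ∀ {V′ v σ} → IsVertexOrder G V′ (σ ∷ʳ v) → v ∈ V′ × IsVertexOrder G (V′ - v) σ
  vertexOrder-∷ʳ⁻ {v = v} {σ} = vertexOrder-∷⁻ ∘ vertexOrder-resp-↭ (↭-sym (∷↭∷ʳ v σ))

  vertexOrder-∷ʳ⁺ : ∀ {V′ v σ} → v ∈ V′ → IsVertexOrder G (V′ - v) σ → IsVertexOrder G V′ (σ ∷ʳ v)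
  vertexOrder-∷ʳ⁺ {v = v} {σ} v∈V′ = vertexOrder-resp-↭ (∷↭∷ʳ v σ) ∘ vertexOrder-∷⁺ v∈V′

  sum-map-vertexOrder : ∀ (h : Fin n → ℕ) {V′} σ →
                        IsVertexOrder G V′ σ → sum (map h σ) ≡ subsetSum h V′
  sum-map-vertexOrder h {V′} [] o = begin
    0              ≡⟨ subsetSum-⊥ h ⟨
    subsetSum h ⊥  ≡⟨ cong (subsetSum h) (Empty-unique (vertexOrder-[]⁻ o)) ⟨
    subsetSum h V′ ∎
    where open ≡-Reasoning
  sum-map-vertexOrder h {V′} (v ∷ σ) o = begin
    h v + sum (map h σ)         ≡⟨ cong (h v +_) (sum-map-vertexOrder h σ o′) ⟩
    h v + subsetSum h (V′ - v)  ≡⟨ subsetSum-remove h v∈V′ ⟨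
    subsetSum h V′              ∎
    where
    open ≡-Reasoning
    v∈V′ = proj₁ (vertexOrder-∷⁻ o)
    o′   = proj₂ (vertexOrder-∷⁻ o)

  deg≡subsetSum : ∀ v V′ → deg G v V′ ≡ subsetSum (mult v) V′
  deg≡subsetSum v V′ =
    trans (cong sum (map-tabulate (λ u → u) (λ u → if lookup V′ u then mult v u else 0)))
          (sum-tabulate≡subsetSum (mult v) V′)

  degList-last : ∀ {v V′ σ} → v ∈ V′ → IsVertexOrder G (V′ - v) σ → degList G v σ ≡ deg G v V′
  degList-last {v} {V′} {σ} v∈V′ o = begin
    degList G v σ                           ≡⟨ sum-map-vertexOrder (mult v) σ o ⟩
    subsetSum (mult v) (V′ - v)             ≡⟨ cong (_+ subsetSum (mult v) (V′ - v)) (loopFree v) ⟨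
    mult v v + subsetSum (mult v) (V′ - v)  ≡⟨ subsetSum-remove (mult v) v∈V′ ⟨
    subsetSum (mult v) V′                   ≡⟨ deg≡subsetSum v V′ ⟨
    deg G v V′                              ∎
    where open ≡-Reasoning

  module _ {c ℓ} (M : TotalOrderedCommMonoid c ℓ) where
    open TotalOrderedCommMonoid M renaming (_+_ to _∙_)

    ∙-identityʳ : ∀ x → x ∙ 0# ≡ x
    ∙-identityʳ x = trans (+-comm x 0#) (+-identityˡ x)

    ≤-reflexive : ∀ {x y} → x ≡ y → x ≤ y
    ≤-reflexive refl = ≤-refl

    ≤-preorder : Preorder c c ℓ
    ≤-preorder = record
      { _≲_        = _≤_
      ; isPreorder = record
        { isEquivalence = isEquivalence
        ; reflexive     = ≤-reflexive
        ; trans         = ≤-trans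
        }
      }

    module ≤-Reasoning = PreorderReasoning ≤-preorder

    costFrom-∷ʳ : ∀ φ pre σ v →
      costFrom G M φ pre (σ ∷ʳ v) ≡ costFrom G M φ pre σ ∙ φ v (degList G v σ + degList G v pre)
    costFrom-∷ʳ φ pre [] v = trans (∙-identityʳ _) (sym (+-identityˡ _))
    costFrom-∷ʳ φ pre (x ∷ σ) v = begin
      φₓ ∙ costFrom G M φ (x ∷ pre) (σ ∷ʳ v)
        ≡⟨ cong (φₓ ∙_) (costFrom-∷ʳ φ (x ∷ pre) σ v) ⟩
      φₓ ∙ (rest ∙ φ v (degList G v σ + (mult v x + degList G v pre)))
        ≡⟨ cong (λ k → φₓ ∙ (rest ∙ φ v k)) (x∙yz≈yx∙z (degList G v σ) (mult v x) _) ⟩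
      φₓ ∙ (rest ∙ φ v ((mult v x + degList G v σ) + degList G v pre))
        ≡⟨ +-assoc φₓ rest _ ⟨
      (φₓ ∙ rest) ∙ φ v (degList G v (x ∷ σ) + degList G v pre)
        ∎
      where
      open ≡-Reasoning
      φₓ   = φ x (degList G x pre)
      rest = costFrom G M φ (x ∷ pre) σ

    orderCost-∷ʳ : ∀ φ σ v → orderCost G M φ (σ ∷ʳ v) ≡ orderCost G M φ σ ∙ φ v (degList G v σ)
    orderCost-∷ʳ φ σ v =
      trans (costFrom-∷ʳ φ [] σ v) (cong (λ k → orderCost G M φ σ ∙ φ v k) (ℕ.+-identityʳ _))

    module _ (φ : Fin n → ℕ → Carrier) (f : Subset n → Carrier) where

      Attains : Subset n → List (Fin n) → Set c
      Attains V′ σ = IsVertexOrder G V′ σ × orderCost G M φ σ ≡ f V′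

      attains-∷ʳ : ∀ {V′ v τ} → v ∈ V′ → f V′ ≡ f (V′ - v) ∙ φ v (deg G v V′) →
                   Attains (V′ - v) τ → Attains V′ (τ ∷ʳ v)
      attains-∷ʳ {V′} {v} {τ} v∈V′ f-split (o , cost≡f) = vertexOrder-∷ʳ⁺ v∈V′ o , (begin
        orderCost G M φ (τ ∷ʳ v)                 ≡⟨ orderCost-∷ʳ φ τ v ⟩
        orderCost G M φ τ ∙ φ v (degList G v τ)  ≡⟨ cong₂ (λ a k → a ∙ φ v k) cost≡f
                                                              (degList-last v∈V′ o) ⟩
        f (V′ - v) ∙ φ v (deg G v V′)            ≡⟨ f-split ⟨
        f V′                                     ∎)
        where open ≡-Reasoning

      module _ (isF : IsF G M φ f) where

        f-Empty : ∀ {V′} → Empty V′ → f V′ ≡ 0#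
        f-Empty V′-empty = trans (cong f (Empty-unique V′-empty)) (proj₁ isF)

        f≤orderCost : ∀ {V′} σ → IsVertexOrder G V′ σ → f V′ ≤ orderCost G M φ σ
        f≤orderCost σ = bound (reverseView σ)
          where
          open ≤-Reasoning
          bound : ∀ {V′ σ} → Reverse σ → IsVertexOrder G V′ σ → f V′ ≤ orderCost G M φ σ
          bound [] o = ≤-reflexive (f-Empty (vertexOrder-[]⁻ o))
          bound {V′} (σ ∶ rσ ∶ʳ v) o with vertexOrder-∷ʳ⁻ o
          ... | v∈V′ , o′ = begin
            f V′                                     ≲⟨ proj₁ (proj₂ isF V′ (v , v∈V′)) v v∈V′ ⟩
            f (V′ - v) ∙ φ v (deg G v V′)            ≲⟨ +-mono-≤ (bound rσ o′) ≤-refl ⟩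
            orderCost G M φ σ ∙ φ v (deg G v V′)     ≡⟨ cong (λ k → _ ∙ φ v k) (degList-last v∈V′ o′) ⟨
            orderCost G M φ σ ∙ φ v (degList G v σ)  ≡⟨ orderCost-∷ʳ φ σ v ⟨
            orderCost G M φ (σ ∷ʳ v)                 ∎

        attainable : ∀ V′ → ∃ (Attains V′)
        attainable V′ = go V′ (⊂-wellFounded V′)
          where
          go : ∀ V′ → Acc _⊂_ V′ → ∃ (Attains V′)
          go V′ (acc rec) with nonempty? V′
          ... | no  V′-empty    = [] , vertexOrder-[]⁺ V′-empty , sym (f-Empty V′-empty)
          ... | yes V′-nonempty =
            let v , v∈V′ , f-split = proj₂ (proj₂ isF V′ V′-nonempty)
                τ , τ-attains      = go (V′ - v) (rec (x∈p⇒p-x⊂p v∈V′))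
            in τ ∷ʳ v , attains-∷ʳ v∈V′ f-split τ-attains

theorem14 : ∀ {c ℓ} (M : TotalOrderedCommMonoid c ℓ) {n : ℕ} (G : Multigraph n)
    (φ : Fin n → ℕ → TotalOrderedCommMonoid.Carrier M)
    (f : Subset n → TotalOrderedCommMonoid.Carrier M) (g : Subset n → Fin n) →
    IsF G M φ f → IsG G M φ f g →
    ∀ (V′ : Subset n) → Nonempty V′ →
      (∀ σ → IsVertexOrder G V′ σ →
         TotalOrderedCommMonoid._≤_ M (f V′) (orderCost G M φ σ)) ×
      (∃ λ τ → IsVertexOrder G V′ (τ ++ [ g V′ ]) ×
         orderCost G M φ (τ ++ [ g V′ ]) ≡ f V′)
theorem14 M G φ f g isF isG V′ V′-nonempty =
  f≤orderCost G M φ f isF ,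
  (let g∈V′ , f-split = isG V′ V′-nonempty
       τ , τ-attains  = attainable G M φ f isF (V′ - g V′)
   in τ , attains-∷ʳ G M φ f g∈V′ f-split τ-attains)
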